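{- There is an absolute constant $C>0$ such that for all integers $n,k\ge 1$ with $n>k$ there exists a DNNF circuit of size at most $n^{Ck}$ expressing $\mathrm{lintop}_{n,k}$ (i.e., $\mathrm{lintop}_{n,k}$ has DNNF circuits of size $n^{O(k)}$).
   Context: $[n]=\{1,\dots,n\}$. For $n>k$, $\mathrm{lintop}_{n,k}$ is the Boolean function over the variables $\{x_{i,j}: i,j\in[n],\ i\ne j\}$ such that an assignment $\alpha$ satisfies it iff there exist a set $K\subseteq[n]$ with $|K|=k$ and a linear order $\prec$ on $K$ such that for all distinct $i,j\in[n]$: $\alpha(x_{i,j})=1$ if $i,j\in K$ and $i\prec j$; $\alpha(x_{i,j})=0$ if $i,j\in K$ and $j\prec i$; $\alpha(x_{i,j})=1$ if $i\in K$, $j\notin K$; $\alpha(x_{i,j})=0$ if $j\in K$, $i\notin K$; and $\alpha(x_{i,j})=0$ if $i,j\notin K$. A Boolean circuit in NNF is a rooted DAG with leaves labelled $\top$, $\bot$, $x$ or $\neg x$ for variables $x$, and internal nodes labelled $\wedge$ or $\vee$; it is a DNNF circuit if for every $\wedge$-node any two children root subcircuits with disjoint variable sets. A circuit expresses a function if it computes it on every assignment. Size is the number of nodes and edges. -}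

module Defs where

open import Data.Nat using (ℕ; zero; suc; _+_)
open import Data.Fin using (Fin; zero; suc)
open import Data.Fin.Subset using (Subset; _∈_; ∣_∣)
open import Data.Bool using (Bool; true; false; _∧_; _∨_; not)
open import Data.List using (List; []; _∷_; length; lookup; concatMap; map)
open import Data.Bool.ListAction using (all; any)
import Data.List.Membership.Propositional as LM
open import Data.Product using (Σ; ∃; _×_; _,_)
open import Data.Sum using (_⊎_)
open import Data.Unit using (⊤)
open import Data.Empty using (⊥)
open import Relation.Binary.PropositionalEquality using (_≡_; _≢_)

-- A DAG with m nodes is built by successively adding gates; a gate added
-- on top of a DAG with m nodes may only point to those m earlier nodes
-- (children are given as a list of indices, one entry per edge).
-- In  D ▷ g  the new gate has index zero and old node i has index suc i.
-- The root of a nonempty DAG is the last added gate (index zero).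

data Gate (V : Set) (m : ℕ) : Set where
  top bot : Gate V m
  pos neg : V → Gate V m
  and or  : List (Fin m) → Gate V m

data DAG (V : Set) : ℕ → Set where
  []  : DAG V 0
  _▷_ : ∀ {m} → DAG V m → Gate V m → DAG V (suc m)

infixl 5 _▷_

evalGate : ∀ {V m} → (V → Bool) → (Fin m → Bool) → Gate V m → Bool
evalGate a v top      = true
evalGate a v bot      = false
evalGate a v (pos x)  = a x
evalGate a v (neg x)  = not (a x)
evalGate a v (and cs) = all v cs
evalGate a v (or cs)  = any v cs

val : ∀ {V m} → DAG V m → (V → Bool) → Fin m → Bool
val (D ▷ g) a zero    = evalGate a (val D a) g
val (D ▷ g) a (suc i) = val D a i

eval : ∀ {V m} → DAG V (suc m) → (V → Bool) → Bool
eval D a = val D a zero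

gateVars : ∀ {V m} → (Fin m → List V) → Gate V m → List V
gateVars vs top      = []
gateVars vs bot      = []
gateVars vs (pos x)  = x ∷ []
gateVars vs (neg x)  = x ∷ []
gateVars vs (and cs) = concatMap vs cs
gateVars vs (or cs)  = concatMap vs cs

vars : ∀ {V m} → DAG V m → Fin m → List V
vars (D ▷ g) zero    = gateVars (vars D) g
vars (D ▷ g) (suc i) = vars D i

Disjoint : {V : Set} → List V → List V → Set
Disjoint xs ys = ∀ {x} → x LM.∈ xs → x LM.∈ ys → ⊥

Decomposable : ∀ {V m} → DAG V m → Gate V m → Set
Decomposable D (and cs) =
  (p q : Fin (length cs)) → p ≢ q → Disjoint (vars D (lookup cs p)) (vars D (lookup cs q))
Decomposable D _ = ⊤

IsDNNF : ∀ {V m} → DAG V m → Set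
IsDNNF []      = ⊤
IsDNNF (D ▷ g) = IsDNNF D × Decomposable D g

arity : ∀ {V m} → Gate V m → ℕ
arity (and cs) = length cs
arity (or cs)  = length cs
arity _        = 0

size : ∀ {V m} → DAG V m → ℕ
size []      = 0
size (D ▷ g) = size D + suc (arity g)

gateVarsOK : ∀ {V m} → (V → Set) → Gate V m → Set
gateVarsOK P (pos x) = P x
gateVarsOK P (neg x) = P x
gateVarsOK P _       = ⊤

LeavesIn : ∀ {V m} → (V → Set) → DAG V m → Set
LeavesIn P []      = ⊤
LeavesIn P (D ▷ g) = LeavesIn P D × gateVarsOK P g

-- Variables x_{i,j} are pairs (i , j) : Fin n × Fin n with
-- i ≢ j; an assignment is α : Fin n → Fin n → Bool (diagonal values are
-- irrelevant: lintop does not constrain them and circuits cannot read them).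

Var : ℕ → Set
Var n = Fin n × Fin n

OffDiag : ∀ {n} → Var n → Set
OffDiag (i , j) = i ≢ j

IsLinearOrderOn : ∀ {n} → Subset n → (Fin n → Fin n → Set) → Set
IsLinearOrderOn {n} K _≺_ =
  (∀ i → i ∈ K → ¬≺ i) ×
  (∀ i j l → i ∈ K → j ∈ K → l ∈ K → i ≺ j → j ≺ l → i ≺ l) ×
  (∀ i j → i ∈ K → j ∈ K → i ≢ j → (i ≺ j) ⊎ (j ≺ i))
  where ¬≺ : Fin n → Set
        ¬≺ i = i ≺ i → ⊥

lintop : (n k : ℕ) → (Fin n → Fin n → Bool) → Set₁
lintop n k α =
  Σ (Subset n) λ K → ∣ K ∣ ≡ k × Σ (Fin n → Fin n → Set) λ _≺_ →
    IsLinearOrderOn K _≺_ ×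
    (∀ i j → i ≢ j →
       (i ∈ K → j ∈ K → i ≺ j → α i j ≡ true) ×
       (i ∈ K → j ∈ K → j ≺ i → α i j ≡ false) ×
       (i ∈ K → (j ∈ K → ⊥) → α i j ≡ true) ×
       ((i ∈ K → ⊥) → j ∈ K → α i j ≡ false) ×
       ((i ∈ K → ⊥) → (j ∈ K → ⊥) → α i j ≡ false))

Expresses : ∀ {n m} → (k : ℕ) → DAG (Var n) (suc m) → Set₁
Expresses {n} k D =
  ∀ (α : Fin n → Fin n → Bool) →
    (eval D (λ v → α (Data.Product.proj₁ v) (Data.Product.proj₂ v)) ≡ true → lintop n k α) ×
    (lintop n k α → eval D (λ v → α (Data.Product.proj₁ v) (Data.Product.proj₂ v)) ≡ true)

-- An assignment satisfies lintop n k iff it is the precedence matrix of a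
-- repetition-free sequence σ of k vertices: α i j is true iff i occurs in σ and j
-- does not occur before it (sorting K along ≺ gives σ).  So lintop n k is the
-- disjunction, over the at most n ^ k such σ, of the minterm on the n (n - 1)
-- variables that fixes this matrix.  A disjunction of minterms over a fixed
-- duplicate-free list of variables is a DNNF: each minterm is a chain of binary ∧
-- gates conjoining a literal on a fresh variable with the conjunction so far.
-- Its size is 1 + n ^ k (4 n² + 4) at most, below n ^ (7 k) as n ≥ 2.
module Submission where

open import Defs
open import Data.Bool using (Bool; true; false; _∧_; _∨_; not; if_then_else_)
open import Data.Empty using (⊥-elim)
open import Data.Fin using (Fin; zero; suc; _≟_)
open import Data.Fin.Subset using (Subset; _∈_; _∉_; _⊆_; ∣_∣; ⁅_⁆; _∪_; _-_; Nonempty; inside; outside)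
  renaming (⊥ to ∅)
open import Data.Fin.Subset.Properties
  using (p─⊥≡p; p─q⊆p; ⊆-antisym; x∈p∪q⁻; x∈p∪q⁺; x∈⁅x⁆; x∈⁅y⁆⇒x≡y; x∈p∧x≢y⇒x∈p-y; ∉⊥;
         Empty-unique; ∣⊥∣≡0; nonempty?; _∈?_)
open import Data.List
  using (List; []; _∷_; length; map; filter; _++_; allFin; cartesianProduct; cartesianProductWith)
open import Data.List.Membership.Propositional using (find; lose) renaming (_∈_ to _∈ₗ_; _∉_ to _∉ₗ_)
open import Data.List.Membership.Propositional.Properties
  using (∈-allFin; ∈-++⁻; ∈-filter⁺; ∈-filter⁻; ∈-cartesianProduct⁺; ∈-cartesianProductWith⁺)
open import Data.List.Properties using (length-map; length-++; length-filter; length-tabulate)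
import Data.List.Relation.Unary.All as All
open import Data.List.Relation.Unary.All using (All; []; _∷_)
open import Data.List.Relation.Unary.All.Properties using (All¬⇒¬Any)
open import Data.List.Relation.Unary.Any using (Any; here; there)
open import Data.List.Relation.Unary.Any.Properties using (map⁺; map⁻)
open import Data.List.Relation.Unary.AllPairs using (_∷_)
open import Data.List.Relation.Unary.Unique.Propositional using (Unique)
open import Data.List.Relation.Unary.Unique.Propositional.Properties
  using (filter⁺; cartesianProduct⁺; allFin⁺)
import Data.Nat as ℕ
open import Data.Nat using (ℕ; zero; suc; _+_; _*_; _^_; _≤_; _<_; z≤n; s≤s)
open import Data.Nat.Properties
  using (0≢1+n; suc-injective; +-identityʳ; +-assoc; +-suc; *-suc; *-assoc; *-distribˡ-+; ≤-trans; ≤-reflexive;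
         +-monoʳ-≤; +-monoˡ-≤; *-monoʳ-≤; *-monoˡ-≤; *-mono-≤; m≤m+n; m^n>0; ^-monoˡ-≤; ^-monoʳ-≤;
         ^-distribˡ-+-*; module ≤-Reasoning)
open import Data.Nat.Tactic.RingSolver using (solve-∀)
open import Data.Product using (Σ; ∃; _×_; _,_; proj₁; proj₂)
open import Data.Sum using (_⊎_; inj₁; inj₂; [_,_]′)
open import Data.Unit using (tt)
import Data.Vec as Vec
open import Data.Vec using (Vec; []; _∷_)
open import Function using (_∘_; case_of_)
open import Relation.Nullary using (yes; no; does; contradiction; ¬?)
open import Relation.Binary.PropositionalEquality
  using (_≡_; _≢_; refl; sym; trans; cong; cong₂; subst; module ≡-Reasoning)

x∈p⇒∣p∣≡1+∣p-x∣ : ∀ {n x} {p : Subset n} → x ∈ p → ∣ p ∣ ≡ suc ∣ p - x ∣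
x∈p⇒∣p∣≡1+∣p-x∣ {p = inside ∷ p} Vec.here = cong suc (cong ∣_∣ (sym (p─⊥≡p p)))
x∈p⇒∣p∣≡1+∣p-x∣ {p = inside ∷ p} (Vec.there x∈p) = cong suc (x∈p⇒∣p∣≡1+∣p-x∣ x∈p)
x∈p⇒∣p∣≡1+∣p-x∣ {p = outside ∷ p} (Vec.there x∈p) = x∈p⇒∣p∣≡1+∣p-x∣ x∈p

x∈p⇒⁅x⁆∪[p-x]≡p : ∀ {n x} {p : Subset n} → x ∈ p → ⁅ x ⁆ ∪ (p - x) ≡ p
x∈p⇒⁅x⁆∪[p-x]≡p {x = x} {p} x∈p = ⊆-antisym ⊆p p⊆
  where
  ⊆p : ⁅ x ⁆ ∪ (p - x) ⊆ p
  ⊆p y∈ with x∈p∪q⁻ ⁅ x ⁆ (p - x) y∈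
  ... | inj₁ y∈⁅x⁆ = subst (_∈ p) (sym (x∈⁅y⁆⇒x≡y x y∈⁅x⁆)) x∈p
  ... | inj₂ y∈p-x = p─q⊆p p ⁅ x ⁆ y∈p-x
  p⊆ : p ⊆ ⁅ x ⁆ ∪ (p - x)
  p⊆ {y} y∈p with y ≟ x
  ... | yes refl = x∈p∪q⁺ (inj₁ (x∈⁅x⁆ x))
  ... | no y≢x = x∈p∪q⁺ (inj₂ (x∈p∧x≢y⇒x∈p-y y∈p y≢x))

∣p∣≡0⇒p≡∅ : ∀ {n} {p : Subset n} → ∣ p ∣ ≡ 0 → p ≡ ∅
∣p∣≡0⇒p≡∅ ∣p∣≡0 = Empty-unique λ (x , x∈p) → 0≢1+n (trans (sym ∣p∣≡0) (x∈p⇒∣p∣≡1+∣p-x∣ x∈p))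

∣p∣≡1+s⇒Nonempty : ∀ {n s} {p : Subset n} → ∣ p ∣ ≡ suc s → Nonempty p
∣p∣≡1+s⇒Nonempty {n} {p = p} ∣p∣≡1+s with nonempty? p
... | yes ne = ne
... | no empty =
  contradiction (trans (sym (∣⊥∣≡0 n)) (trans (cong ∣_∣ (sym (Empty-unique empty))) ∣p∣≡1+s)) 0≢1+n

-- Sequences of vertices, and sorting a linearly ordered subset

support : ∀ {n s} → Vec (Fin n) s → Subset n
support []      = ∅
support (x ∷ σ) = ⁅ x ⁆ ∪ support σ

-- i occurs in σ before any occurrence of j (j need not occur).
precedes : ∀ {n s} → Vec (Fin n) s → Fin n → Fin n → Bool
precedes []      i j = false
precedes (x ∷ σ) i j =
  if does (x ≟ i) then not (does (x ≟ j)) else (if does (x ≟ j) then false else precedes σ i j)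

module _ {n : ℕ} where

  x∈support[x∷σ] : ∀ {s} x (σ : Vec (Fin n) s) → x ∈ support (x ∷ σ)
  x∈support[x∷σ] x σ = x∈p∪q⁺ (inj₁ (x∈⁅x⁆ x))

  ∈support[x∷σ]⁺ : ∀ {s} x (σ : Vec (Fin n) s) {i} → i ∈ support σ → i ∈ support (x ∷ σ)
  ∈support[x∷σ]⁺ x σ i∈σ = x∈p∪q⁺ {p = ⁅ x ⁆} (inj₂ i∈σ)

  ∈support[x∷σ]⁻ : ∀ {s} x (σ : Vec (Fin n) s) {i} → i ∈ support (x ∷ σ) → x ≢ i → i ∈ support σ
  ∈support[x∷σ]⁻ x σ i∈ x≢i with x∈p∪q⁻ ⁅ x ⁆ (support σ) i∈
  ... | inj₁ i∈⁅x⁆ = ⊥-elim (x≢i (sym (x∈⁅y⁆⇒x≡y x i∈⁅x⁆)))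
  ... | inj₂ i∈σ  = i∈σ

  precedes-irrefl : ∀ {s} (σ : Vec (Fin n) s) i → precedes σ i i ≡ false
  precedes-irrefl []      i = refl
  precedes-irrefl (x ∷ σ) i with x ≟ i
  ... | yes _ = refl
  ... | no  _ = precedes-irrefl σ i

  precedes-asym : ∀ {s} (σ : Vec (Fin n) s) i j → precedes σ j i ≡ true → precedes σ i j ≡ false
  precedes-asym (x ∷ σ) i j ji with x ≟ i | x ≟ j
  precedes-asym (x ∷ σ) i j ()  | yes _ | no  _
  ... | yes _ | yes _ = refl
  ... | no  _ | yes _ = refl
  ... | no  _ | no  _ = precedes-asym σ i j ji

  precedes-trans : ∀ {s} (σ : Vec (Fin n) s) i j l →
                   precedes σ i j ≡ true → precedes σ j l ≡ true → precedes σ i l ≡ true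
  precedes-trans (x ∷ σ) i j l ij jl with x ≟ i | x ≟ j | x ≟ l
  precedes-trans (x ∷ σ) i j l () jl | yes _ | yes _ | _
  precedes-trans (x ∷ σ) i j l ij () | yes _ | no  _ | yes _
  precedes-trans (x ∷ σ) i j l () jl | no  _ | yes _ | _
  ... | yes _ | no  _ | no  _ = refl
  ... | no  _ | no  _ | yes _ = jl
  ... | no  _ | no  _ | no  _ = precedes-trans σ i j l ij jl

  precedes-total : ∀ {s} (σ : Vec (Fin n) s) {i j} → i ∈ support σ → j ∈ support σ → i ≢ j →
                   precedes σ i j ≡ true ⊎ precedes σ j i ≡ true
  precedes-total []      i∈ _ _ = ⊥-elim (∉⊥ i∈)
  precedes-total (x ∷ σ) {i} {j} i∈ j∈ i≢j with x ≟ i | x ≟ j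
  ... | yes refl | yes refl = ⊥-elim (i≢j refl)
  ... | yes _    | no  _    = inj₁ refl
  ... | no  _    | yes _    = inj₂ refl
  ... | no  x≢i  | no  x≢j  = precedes-total σ (∈support[x∷σ]⁻ x σ i∈ x≢i) (∈support[x∷σ]⁻ x σ j∈ x≢j) i≢j

  precedes-∉ : ∀ {s} (σ : Vec (Fin n) s) {i} j → i ∉ support σ → precedes σ i j ≡ false
  precedes-∉ []      j i∉ = refl
  precedes-∉ (x ∷ σ) {i} j i∉ with x ≟ i | x ≟ j
  ... | yes refl | _     = ⊥-elim (i∉ (x∈support[x∷σ] x σ))
  ... | no  _    | yes _ = refl
  ... | no  _    | no  _ = precedes-∉ σ j (λ i∈σ → i∉ (∈support[x∷σ]⁺ x σ i∈σ))

  precedes-∈∉ : ∀ {s} (σ : Vec (Fin n) s) {i j} → i ∈ support σ → j ∉ support σ → precedes σ i j ≡ true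
  precedes-∈∉ []      i∈ _ = ⊥-elim (∉⊥ i∈)
  precedes-∈∉ (x ∷ σ) {i} {j} i∈ j∉ with x ≟ i | x ≟ j
  ... | _       | yes refl = ⊥-elim (j∉ (x∈support[x∷σ] x σ))
  ... | yes _   | no  _    = refl
  ... | no  x≢i | no  _    = precedes-∈∉ σ (∈support[x∷σ]⁻ x σ i∈ x≢i) (λ j∈σ → j∉ (∈support[x∷σ]⁺ x σ j∈σ))

module _ {n : ℕ} {_≺_ : Fin n → Fin n → Set} where

  IsLinearOrderOn-⊆ : ∀ {S T : Subset n} → T ⊆ S → IsLinearOrderOn S _≺_ → IsLinearOrderOn T _≺_
  IsLinearOrderOn-⊆ T⊆S (irrefl , trans′ , total) =
    (λ i i∈ → irrefl i (T⊆S i∈)) ,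
    (λ i j l i∈ j∈ l∈ → trans′ i j l (T⊆S i∈) (T⊆S j∈) (T⊆S l∈)) ,
    (λ i j i∈ j∈ → total i j (T⊆S i∈) (T⊆S j∈))

  leastAmong : ∀ {S} → IsLinearOrderOn S _≺_ → (L : List (Fin n)) → Nonempty S →
               ∃ λ m → m ∈ S × (∀ {y} → y ∈ₗ L → y ∈ S → y ≢ m → m ≺ y)
  leastAmong lin [] (y , y∈S) = y , y∈S , λ ()
  leastAmong {S} lin@(_ , trans′ , total) (x ∷ L) ne with leastAmong lin L ne | x ∈? S
  ... | m , m∈S , least | no x∉S =
    m , m∈S , λ { (here refl) x∈S _ → ⊥-elim (x∉S x∈S) ; (there y∈L) → least y∈L }
  ... | m , m∈S , least | yes x∈S with x ≟ m
  ...   | yes refl =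
    m , m∈S , λ { (here refl) _ x≢x → ⊥-elim (x≢x refl) ; (there y∈L) → least y∈L }
  ...   | no x≢m with total x m x∈S m∈S x≢m
  ...     | inj₂ m≺x = m , m∈S , λ { (here refl) _ _ → m≺x ; (there y∈L) → least y∈L }
  ...     | inj₁ x≺m = x , x∈S , λ
    { (here refl) _ x≢x → ⊥-elim (x≢x refl)
    ; {y} (there y∈L) y∈S _ → case y ≟ m of λ
        { (yes refl) → x≺m
        ; (no y≢m)   → trans′ x m y x∈S m∈S y∈S x≺m (least y∈L y∈S y≢m) } }

  least : ∀ {S} → IsLinearOrderOn S _≺_ → Nonempty S → ∃ λ m → m ∈ S × (∀ {y} → y ∈ S → y ≢ m → m ≺ y)
  least lin ne with leastAmong lin (allFin n) ne
  ... | m , m∈S , m-least = m , m∈S , λ {y} → m-least (∈-allFin y)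

sort : ∀ {n s} {S : Subset n} {_≺_ : Fin n → Fin n → Set} → ∣ S ∣ ≡ s → IsLinearOrderOn S _≺_ →
       ∃ λ (σ : Vec (Fin n) s) → support σ ≡ S × (∀ {i j} → i ∈ S → j ∈ S → i ≺ j → precedes σ i j ≡ true)
sort {s = zero} {S} ∣S∣≡0 _ = [] , sym S≡∅ , λ i∈S → ⊥-elim (∉⊥ (subst (_ ∈_) S≡∅ i∈S))
  where
  S≡∅ : S ≡ ∅
  S≡∅ = ∣p∣≡0⇒p≡∅ ∣S∣≡0
sort {s = suc s} {S} {_≺_} ∣S∣≡1+s lin@(irrefl , trans′ , _)
  with least lin (∣p∣≡1+s⇒Nonempty ∣S∣≡1+s)
... | m , m∈S , m-least
  with sort (suc-injective (trans (sym (x∈p⇒∣p∣≡1+∣p-x∣ m∈S)) ∣S∣≡1+s))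
            (IsLinearOrderOn-⊆ (p─q⊆p S ⁅ m ⁆) lin)
... | σ , support≡S-m , sorted =
  m ∷ σ , trans (cong (⁅ m ⁆ ∪_) support≡S-m) (x∈p⇒⁅x⁆∪[p-x]≡p m∈S) , sorted′
  where
  sorted′ : ∀ {i j} → i ∈ S → j ∈ S → i ≺ j → precedes (m ∷ σ) i j ≡ true
  sorted′ {i} {j} i∈S j∈S i≺j with m ≟ i | m ≟ j
  ... | yes refl | yes refl = ⊥-elim (irrefl i i∈S i≺j)
  ... | yes _    | no  _    = refl
  ... | no m≢i   | yes refl = ⊥-elim (irrefl i i∈S (trans′ i m i i∈S m∈S i∈S i≺j (m-least i∈S (m≢i ∘ sym))))
  ... | no m≢i   | no m≢j   =
    sorted (x∈p∧x≢y⇒x∈p-y i∈S (m≢i ∘ sym)) (x∈p∧x≢y⇒x∈p-y j∈S (m≢j ∘ sym)) i≺j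

precedes-lintop : ∀ {n s k α} (σ : Vec (Fin n) s) → ∣ support σ ∣ ≡ k →
                  (∀ i j → i ≢ j → α i j ≡ precedes σ i j) → lintop n k α
precedes-lintop σ ∣σ∣≡k α≡ =
  support σ , ∣σ∣≡k , (λ i j → precedes σ i j ≡ true) ,
  ( (λ i _ i≺i → case trans (sym (precedes-irrefl σ i)) i≺i of λ ())
  , (λ i j l _ _ _ → precedes-trans σ i j l)
  , (λ i j i∈ j∈ → precedes-total σ i∈ j∈) ) ,
  λ i j i≢j →
    (λ _ _ i≺j → trans (α≡ i j i≢j) i≺j) ,
    (λ _ _ j≺i → trans (α≡ i j i≢j) (precedes-asym σ i j j≺i)) ,
    (λ i∈ j∉ → trans (α≡ i j i≢j) (precedes-∈∉ σ i∈ j∉)) ,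
    (λ i∉ _ → trans (α≡ i j i≢j) (precedes-∉ σ j i∉)) ,
    (λ i∉ _ → trans (α≡ i j i≢j) (precedes-∉ σ j i∉))

lintop-precedes : ∀ {n k α} → lintop n k α →
                  ∃ λ (σ : Vec (Fin n) k) → ∣ support σ ∣ ≡ k × (∀ i j → i ≢ j → α i j ≡ precedes σ i j)
lintop-precedes {α = α} (K , ∣K∣≡k , _≺_ , lin@(_ , _ , total) , α-agrees) with sort ∣K∣≡k lin
... | σ , σ≡K , sorted = σ , trans (cong ∣_∣ σ≡K) ∣K∣≡k , agree
  where
  ∈σ : ∀ {i} → i ∈ K → i ∈ support σ
  ∈σ = subst (_ ∈_) (sym σ≡K)
  ∉σ : ∀ {i} → i ∉ K → i ∉ support σ
  ∉σ i∉K = i∉K ∘ subst (_ ∈_) σ≡K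
  agree : ∀ i j → i ≢ j → α i j ≡ precedes σ i j
  agree i j i≢j with α-agrees i j i≢j
  ... | ≺⇒1 , ≻⇒0 , in-out , out-in , out-out with i ∈? K | j ∈? K
  ... | yes i∈K | yes j∈K =
    [ (λ i≺j → trans (≺⇒1 i∈K j∈K i≺j) (sym (sorted i∈K j∈K i≺j)))
    , (λ j≺i → trans (≻⇒0 i∈K j∈K j≺i) (sym (precedes-asym σ i j (sorted j∈K i∈K j≺i))))
    ]′ (total i j i∈K j∈K i≢j)
  ... | yes i∈K | no j∉K = trans (in-out i∈K j∉K) (sym (precedes-∈∉ σ (∈σ i∈K) (∉σ j∉K)))
  ... | no i∉K  | yes j∈K = trans (out-in i∉K j∈K) (sym (precedes-∉ σ j (∉σ i∉K)))
  ... | no i∉K  | no j∉K = trans (out-out i∉K j∉K) (sym (precedes-∉ σ j (∉σ i∉K)))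

-- DNNF circuits for disjunctions of minterms

Circuit : Set → Set
Circuit V = Σ ℕ λ m → DAG V (suc m)

Agrees : ∀ {V : Set} → (V → Bool) → (V → Bool) → List V → Set
Agrees a β xs = All (λ x → a x ≡ β x) xs

private
  ∧-true⁻ : ∀ {x y} → x ∧ y ≡ true → x ≡ true × y ≡ true
  ∧-true⁻ {true} {true} _ = refl , refl

  ∧-true⁺ : ∀ {x y} → x ≡ true → y ≡ true → x ∧ y ≡ true
  ∧-true⁺ refl refl = refl

  ∨-true⁻ : ∀ {x y} → x ∨ y ≡ true → x ≡ true ⊎ y ≡ true
  ∨-true⁻ {true}  _ = inj₁ refl
  ∨-true⁻ {false} y = inj₂ y

  ∨-true⁺ : ∀ x {y} → x ≡ true ⊎ y ≡ true → x ∨ y ≡ true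
  ∨-true⁺ _     (inj₁ refl) = refl
  ∨-true⁺ true  (inj₂ _)    = refl
  ∨-true⁺ false (inj₂ y)    = y

module _ {V : Set} where

  literal : ∀ {m} → Bool → V → Gate V m
  literal true  x = pos x
  literal false x = neg x

  module _ {m : ℕ} {a : V → Bool} {v : Fin m → Bool} where

    literal-sound : ∀ b x → evalGate a v (literal b x) ≡ true → a x ≡ b
    literal-sound true  x ax = ax
    literal-sound false x not-ax with a x
    literal-sound false x () | true
    ... | false = refl

    literal-complete : ∀ b x → a x ≡ b → evalGate a v (literal b x) ≡ true
    literal-complete true  x ax = ax
    literal-complete false x ax = cong not ax

  module _ {m : ℕ} where

    gateVars-literal : ∀ (vs : Fin m → List V) b x → gateVars vs (literal b x) ≡ x ∷ []
    gateVars-literal vs true  x = refl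
    gateVars-literal vs false x = refl

    arity-literal : ∀ b x → arity {V} {m} (literal b x) ≡ 0
    arity-literal true  x = refl
    arity-literal false x = refl

    literal-decomposable : ∀ (D : DAG V m) b x → Decomposable D (literal b x)
    literal-decomposable D true  x = tt
    literal-decomposable D false x = tt

    literal-varsOK : ∀ {P : V → Set} b x → P x → gateVarsOK {V} {m} P (literal b x)
    literal-varsOK true  x px = px
    literal-varsOK false x px = px

  module _ (β : V → Bool) where

    infixl 5 _∧lit_
    _∧lit_ : ∀ {m} → DAG V (suc m) → V → DAG V (suc (suc (suc m)))
    D ∧lit x = D ▷ literal (β x) x ▷ and (zero ∷ suc zero ∷ [])

    module _ {m : ℕ} (D : DAG V (suc m)) (x : V) where

      eval-∧lit⁻ : ∀ {a} → eval (D ∧lit x) a ≡ true → a x ≡ β x × eval D a ≡ true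
      eval-∧lit⁻ root with ∧-true⁻ root
      ... | lit , rest = literal-sound (β x) x lit , proj₁ (∧-true⁻ rest)

      eval-∧lit⁺ : ∀ {a} → a x ≡ β x → eval D a ≡ true → eval (D ∧lit x) a ≡ true
      eval-∧lit⁺ ax≡βx root = ∧-true⁺ (literal-complete (β x) x ax≡βx) (∧-true⁺ root refl)

      vars-∧lit : ∀ {y} → y ∈ₗ vars (D ∧lit x) zero → y ≡ x ⊎ y ∈ₗ vars D zero
      vars-∧lit y∈ with ∈-++⁻ (gateVars (vars D) (literal (β x) x)) y∈
      ... | inj₁ y∈lit with subst (_ ∈ₗ_) (gateVars-literal (vars D) (β x) x) y∈lit
      ...   | here y≡x = inj₁ y≡x
      vars-∧lit y∈ | inj₂ y∈D with ∈-++⁻ (vars D zero) y∈D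
      ... | inj₁ y∈D′ = inj₂ y∈D′

      isDNNF-∧lit : IsDNNF D → x ∉ₗ vars D zero → IsDNNF (D ∧lit x)
      isDNNF-∧lit dnnf x∉D = (dnnf , literal-decomposable D (β x) x) , disjoint
        where
        x∈lit⇒≡ : ∀ {y} → y ∈ₗ vars (D ▷ literal (β x) x) zero → y ≡ x
        x∈lit⇒≡ y∈ with subst (_ ∈ₗ_) (gateVars-literal (vars D) (β x) x) y∈
        ... | here y≡x = y≡x
        disjoint : Decomposable (D ▷ literal (β x) x) (and (zero ∷ suc zero ∷ []))
        disjoint zero       zero       0≢0 = ⊥-elim (0≢0 refl)
        disjoint zero       (suc zero) _ y∈lit y∈D with x∈lit⇒≡ y∈lit
        ... | refl = x∉D y∈D
        disjoint (suc zero) zero       _ y∈D y∈lit with x∈lit⇒≡ y∈lit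
        ... | refl = x∉D y∈D
        disjoint (suc zero) (suc zero) 1≢1 = ⊥-elim (1≢1 refl)

      leavesIn-∧lit : ∀ {P : V → Set} → LeavesIn P D → P x → LeavesIn P (D ∧lit x)
      leavesIn-∧lit leaves px = (leaves , literal-varsOK (β x) x px) , tt

      size-∧lit : size (D ∧lit x) ≡ size D + 4
      size-∧lit rewrite arity-literal {suc m} (β x) x = +-assoc (size D) 1 3

    conjoin : ∀ {m} → DAG V (suc m) → List V → Circuit V
    conjoin D []       = _ , D
    conjoin D (x ∷ xs) = conjoin (D ∧lit x) xs

    conjoin-↑ : ∀ {m} (D : DAG V (suc m)) xs → Fin (suc m) → Fin (suc (proj₁ (conjoin D xs)))
    conjoin-↑ D []       i = i
    conjoin-↑ D (x ∷ xs) i = conjoin-↑ (D ∧lit x) xs (suc (suc i))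

    val-conjoin-↑ : ∀ {m} (D : DAG V (suc m)) xs a i →
                    val (proj₂ (conjoin D xs)) a (conjoin-↑ D xs i) ≡ val D a i
    val-conjoin-↑ D []       a i = refl
    val-conjoin-↑ D (x ∷ xs) a i = val-conjoin-↑ (D ∧lit x) xs a (suc (suc i))

    eval-conjoin⁻ : ∀ {m} (D : DAG V (suc m)) xs {a} →
                    eval (proj₂ (conjoin D xs)) a ≡ true → eval D a ≡ true × Agrees a β xs
    eval-conjoin⁻ D []       root = root , []
    eval-conjoin⁻ D (x ∷ xs) root with eval-conjoin⁻ (D ∧lit x) xs root
    ... | root′ , agrees with eval-∧lit⁻ D x root′
    ...   | ax≡βx , rootD = rootD , ax≡βx ∷ agrees

    eval-conjoin⁺ : ∀ {m} (D : DAG V (suc m)) xs {a} →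
                    eval D a ≡ true → Agrees a β xs → eval (proj₂ (conjoin D xs)) a ≡ true
    eval-conjoin⁺ D []       root []                = root
    eval-conjoin⁺ D (x ∷ xs) root (ax≡βx ∷ agrees) =
      eval-conjoin⁺ (D ∧lit x) xs (eval-∧lit⁺ D x ax≡βx root) agrees

    isDNNF-conjoin : ∀ {m} (D : DAG V (suc m)) {xs} → IsDNNF D → Unique xs →
                     (∀ {y} → y ∈ₗ vars D zero → y ∉ₗ xs) → IsDNNF (proj₂ (conjoin D xs))
    isDNNF-conjoin D {[]}     dnnf _              _      = dnnf
    isDNNF-conjoin D {x ∷ xs} dnnf (x∉xs ∷ unique) fresh =
      isDNNF-conjoin (D ∧lit x) (isDNNF-∧lit D x dnnf (λ x∈D → fresh x∈D (here refl))) unique fresh′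
      where
      fresh′ : ∀ {y} → y ∈ₗ vars (D ∧lit x) zero → y ∉ₗ xs
      fresh′ y∈ y∈xs with vars-∧lit D x y∈
      ... | inj₁ refl = All¬⇒¬Any x∉xs y∈xs
      ... | inj₂ y∈D  = fresh y∈D (there y∈xs)

    leavesIn-conjoin : ∀ {m} {P : V → Set} (D : DAG V (suc m)) {xs} →
                       LeavesIn P D → All P xs → LeavesIn P (proj₂ (conjoin D xs))
    leavesIn-conjoin D leaves []        = leaves
    leavesIn-conjoin D leaves (px ∷ ps) = leavesIn-conjoin (D ∧lit _) (leavesIn-∧lit D _ leaves px) ps

    size-conjoin : ∀ {m} (D : DAG V (suc m)) xs → size (proj₂ (conjoin D xs)) ≡ size D + length xs * 4
    size-conjoin D []       = sym (+-identityʳ (size D))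
    size-conjoin D (x ∷ xs) = begin
      size (proj₂ (conjoin (D ∧lit x) xs)) ≡⟨ size-conjoin (D ∧lit x) xs ⟩
      size (D ∧lit x) + length xs * 4     ≡⟨ cong (_+ length xs * 4) (size-∧lit D x) ⟩
      size D + 4 + length xs * 4          ≡⟨ +-assoc (size D) 4 (length xs * 4) ⟩
      size D + length (x ∷ xs) * 4        ∎
      where open ≡-Reasoning

  module _ (ps : List V) where

    _∨minterm_ : ∀ {m} → DAG V (suc m) → (V → Bool) → Circuit V
    D ∨minterm β =
      _ , proj₂ (conjoin β (D ▷ top) ps) ▷ or (zero ∷ conjoin-↑ β (D ▷ top) ps (suc zero) ∷ [])

    module _ {m : ℕ} (D : DAG V (suc m)) (β : V → Bool) where

      private
        C : Circuit V
        C = conjoin β (D ▷ top) ps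
        val-rootD↑ : ∀ a → val (proj₂ C) a (conjoin-↑ β (D ▷ top) ps (suc zero)) ≡ eval D a
        val-rootD↑ a = val-conjoin-↑ β (D ▷ top) ps a (suc zero)

      eval-∨minterm⁻ : ∀ {a} → eval (proj₂ (D ∨minterm β)) a ≡ true → eval D a ≡ true ⊎ Agrees a β ps
      eval-∨minterm⁻ {a} root with ∨-true⁻ root
      ... | inj₁ holds = inj₂ (proj₂ (eval-conjoin⁻ β (D ▷ top) ps holds))
      ... | inj₂ rest with ∨-true⁻ rest
      ...   | inj₁ rootD = inj₁ (trans (sym (val-rootD↑ a)) rootD)

      eval-∨minterm⁺ : ∀ {a} → eval D a ≡ true ⊎ Agrees a β ps → eval (proj₂ (D ∨minterm β)) a ≡ true
      eval-∨minterm⁺ {a} (inj₁ rootD) =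
        ∨-true⁺ (eval (proj₂ C) a) (inj₂ (∨-true⁺ _ (inj₁ (trans (val-rootD↑ a) rootD))))
      eval-∨minterm⁺ (inj₂ agrees) = ∨-true⁺ _ (inj₁ (eval-conjoin⁺ β (D ▷ top) ps refl agrees))

      isDNNF-∨minterm : Unique ps → IsDNNF D → IsDNNF (proj₂ (D ∨minterm β))
      isDNNF-∨minterm unique dnnf = isDNNF-conjoin β (D ▷ top) (dnnf , tt) unique (λ ()) , tt

      leavesIn-∨minterm : ∀ {P : V → Set} → All P ps → LeavesIn P D → LeavesIn P (proj₂ (D ∨minterm β))
      leavesIn-∨minterm all leaves = leavesIn-conjoin β (D ▷ top) (leaves , tt) all , tt

      size-∨minterm : size (proj₂ (D ∨minterm β)) ≡ size D + (length ps * 4 + 4)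
      size-∨minterm = begin
        size (proj₂ (conjoin β (D ▷ top) ps)) + 3 ≡⟨ cong (_+ 3) (size-conjoin β (D ▷ top) ps) ⟩
        size D + 1 + length ps * 4 + 3           ≡⟨ rearrange (size D) (length ps) ⟩
        size D + (length ps * 4 + 4)             ∎
        where
        open ≡-Reasoning
        rearrange : ∀ s l → s + 1 + l * 4 + 3 ≡ s + (l * 4 + 4)
        rearrange = solve-∀

    disjoin : ∀ {m} → DAG V (suc m) → List (V → Bool) → Circuit V
    disjoin D []       = _ , D
    disjoin D (β ∷ βs) = disjoin (proj₂ (D ∨minterm β)) βs

    eval-disjoin⁻ : ∀ {m} (D : DAG V (suc m)) βs {a} → eval (proj₂ (disjoin D βs)) a ≡ true →
                    eval D a ≡ true ⊎ Any (λ β → Agrees a β ps) βs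
    eval-disjoin⁻ D []       root = inj₁ root
    eval-disjoin⁻ D (β ∷ βs) root with eval-disjoin⁻ (proj₂ (D ∨minterm β)) βs root
    ... | inj₂ later = inj₂ (there later)
    ... | inj₁ root′ with eval-∨minterm⁻ D β root′
    ...   | inj₁ rootD  = inj₁ rootD
    ...   | inj₂ agrees = inj₂ (here agrees)

    eval-disjoin⁺ : ∀ {m} (D : DAG V (suc m)) βs {a} → eval D a ≡ true ⊎ Any (λ β → Agrees a β ps) βs →
                    eval (proj₂ (disjoin D βs)) a ≡ true
    eval-disjoin⁺ D []       (inj₁ rootD) = rootD
    eval-disjoin⁺ D (β ∷ βs) (inj₁ rootD) = eval-disjoin⁺ _ βs (inj₁ (eval-∨minterm⁺ D β (inj₁ rootD)))
    eval-disjoin⁺ D (β ∷ βs) (inj₂ (here agrees)) =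
      eval-disjoin⁺ _ βs (inj₁ (eval-∨minterm⁺ D β (inj₂ agrees)))
    eval-disjoin⁺ D (β ∷ βs) (inj₂ (there later)) = eval-disjoin⁺ _ βs (inj₂ later)

    isDNNF-disjoin : ∀ {m} (D : DAG V (suc m)) βs → Unique ps → IsDNNF D → IsDNNF (proj₂ (disjoin D βs))
    isDNNF-disjoin D []       unique dnnf = dnnf
    isDNNF-disjoin D (β ∷ βs) unique dnnf = isDNNF-disjoin _ βs unique (isDNNF-∨minterm D β unique dnnf)

    leavesIn-disjoin : ∀ {m} {P : V → Set} (D : DAG V (suc m)) βs → All P ps → LeavesIn P D →
                       LeavesIn P (proj₂ (disjoin D βs))
    leavesIn-disjoin D []       all leaves = leaves
    leavesIn-disjoin D (β ∷ βs) all leaves = leavesIn-disjoin _ βs all (leavesIn-∨minterm D β all leaves)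

    size-disjoin : ∀ {m} (D : DAG V (suc m)) βs →
                   size (proj₂ (disjoin D βs)) ≡ size D + length βs * (length ps * 4 + 4)
    size-disjoin D []       = sym (+-identityʳ (size D))
    size-disjoin D (β ∷ βs) = begin
      size (proj₂ (disjoin (proj₂ (D ∨minterm β)) βs))       ≡⟨ size-disjoin _ βs ⟩
      size (proj₂ (D ∨minterm β)) + length βs * c             ≡⟨ cong (_+ length βs * c) (size-∨minterm D β) ⟩
      size D + c + length βs * c                              ≡⟨ +-assoc (size D) c (length βs * c) ⟩
      size D + length (β ∷ βs) * c                            ∎
      where
      open ≡-Reasoning
      c : ℕ
      c = length ps * 4 + 4

    dnf : List (V → Bool) → Circuit V
    dnf = disjoin ([] ▷ bot)

    eval-dnf⁻ : ∀ βs {a} → eval (proj₂ (dnf βs)) a ≡ true → Any (λ β → Agrees a β ps) βs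
    eval-dnf⁻ βs root with eval-disjoin⁻ ([] ▷ bot) βs root
    ... | inj₂ some = some

    eval-dnf⁺ : ∀ βs {a} → Any (λ β → Agrees a β ps) βs → eval (proj₂ (dnf βs)) a ≡ true
    eval-dnf⁺ βs some = eval-disjoin⁺ ([] ▷ bot) βs (inj₂ some)

    isDNNF-dnf : ∀ βs → Unique ps → IsDNNF (proj₂ (dnf βs))
    isDNNF-dnf βs unique = isDNNF-disjoin ([] ▷ bot) βs unique (tt , tt)

    leavesIn-dnf : ∀ {P : V → Set} βs → All P ps → LeavesIn P (proj₂ (dnf βs))
    leavesIn-dnf βs all = leavesIn-disjoin ([] ▷ bot) βs all (tt , tt)

    size-dnf : ∀ βs → size (proj₂ (dnf βs)) ≡ 1 + length βs * (length ps * 4 + 4)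
    size-dnf = size-disjoin ([] ▷ bot)

length-cartesianProductWith : ∀ {A B C : Set} (f : A → B → C) xs ys →
                              length (cartesianProductWith f xs ys) ≡ length xs * length ys
length-cartesianProductWith f []       ys = refl
length-cartesianProductWith f (x ∷ xs) ys = begin
  length (map (f x) ys ++ cartesianProductWith f xs ys)          ≡⟨ length-++ (map (f x) ys) ⟩
  length (map (f x) ys) + length (cartesianProductWith f xs ys) ≡⟨ cong₂ _+_ (length-map (f x) ys)
                                                                     (length-cartesianProductWith f xs ys) ⟩
  length ys + length xs * length ys                              ∎
  where open ≡-Reasoning

length-allFin : ∀ n → length (allFin n) ≡ n
length-allFin n = length-tabulate {n = n} (λ i → i)

vectors : ∀ n k → List (Vec (Fin n) k)
vectors n zero    = [] ∷ []
vectors n (suc k) = cartesianProductWith _∷_ (allFin n) (vectors n k)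

∈-vectors : ∀ {n k} (σ : Vec (Fin n) k) → σ ∈ₗ vectors n k
∈-vectors []      = here refl
∈-vectors (x ∷ σ) = ∈-cartesianProductWith⁺ _∷_ (∈-allFin x) (∈-vectors σ)

length-vectors : ∀ n k → length (vectors n k) ≡ n ^ k
length-vectors n zero    = refl
length-vectors n (suc k) = trans (length-cartesianProductWith _∷_ (allFin n) (vectors n k))
                                 (cong₂ _*_ (length-allFin n) (length-vectors n k))

offDiagonal : ∀ n → List (Var n)
offDiagonal n = filter (λ (i , j) → ¬? (i ≟ j)) (cartesianProduct (allFin n) (allFin n))

module _ {n : ℕ} where

  ∈-offDiagonal⁺ : ∀ {i j : Fin n} → i ≢ j → (i , j) ∈ₗ offDiagonal n
  ∈-offDiagonal⁺ {i} {j} = ∈-filter⁺ _ (∈-cartesianProduct⁺ (∈-allFin i) (∈-allFin j))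

  ∈-offDiagonal⁻ : ∀ {p} → p ∈ₗ offDiagonal n → OffDiag p
  ∈-offDiagonal⁻ = proj₂ ∘ ∈-filter⁻ _ {xs = cartesianProduct (allFin n) (allFin n)}

  module _ {a β : Var n → Bool} where

    agrees-offDiagonal⁻ : Agrees a β (offDiagonal n) → ∀ i j → i ≢ j → a (i , j) ≡ β (i , j)
    agrees-offDiagonal⁻ agrees i j i≢j = All.lookup agrees (∈-offDiagonal⁺ i≢j)

    agrees-offDiagonal⁺ : (∀ i j → i ≢ j → a (i , j) ≡ β (i , j)) → Agrees a β (offDiagonal n)
    agrees-offDiagonal⁺ agree = All.tabulate λ { {i , j} p∈ → agree i j (∈-offDiagonal⁻ p∈) }

offDiagonal-unique : ∀ n → Unique (offDiagonal n)
offDiagonal-unique n = filter⁺ _ (cartesianProduct⁺ (allFin⁺ n) (allFin⁺ n))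

length-offDiagonal : ∀ n → length (offDiagonal n) ≤ n * n
length-offDiagonal n = ≤-trans (length-filter _ (cartesianProduct (allFin n) (allFin n)))
  (≤-reflexive (trans (length-cartesianProductWith _,_ (allFin n) (allFin n))
                      (cong₂ _*_ (length-allFin n) (length-allFin n))))

-- For σ of length k, ∣ support σ ∣ ≡ k says that σ has no repetitions.
orderings : ∀ n k → List (Vec (Fin n) k)
orderings n k = filter (λ σ → ∣ support σ ∣ ℕ.≟ k) (vectors n k)

minterm : ∀ {n s} → Vec (Fin n) s → Var n → Bool
minterm σ (i , j) = precedes σ i j

lintopMinterms : ∀ n k → List (Var n → Bool)
lintopMinterms n k = map minterm (orderings n k)

lintopCircuit : ∀ n k → Circuit (Var n)
lintopCircuit n k = dnf (offDiagonal n) (lintopMinterms n k)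

lintopCircuit-expresses : ∀ n k → Expresses k (proj₂ (lintopCircuit n k))
lintopCircuit-expresses n k α = sound , complete
  where
  a : Var n → Bool
  a (i , j) = α i j
  sound : eval (proj₂ (lintopCircuit n k)) a ≡ true → lintop n k α
  sound root with find (map⁻ (eval-dnf⁻ (offDiagonal n) (lintopMinterms n k) root))
  ... | σ , σ∈ , agrees =
    precedes-lintop σ (proj₂ (∈-filter⁻ _ {xs = vectors n k} σ∈)) (agrees-offDiagonal⁻ agrees)
  complete : lintop n k α → eval (proj₂ (lintopCircuit n k)) a ≡ true
  complete l with lintop-precedes l
  ... | σ , ∣σ∣≡k , α≡ =
    eval-dnf⁺ (offDiagonal n) (lintopMinterms n k)
      (map⁺ (lose (∈-filter⁺ _ (∈-vectors σ) ∣σ∣≡k) (agrees-offDiagonal⁺ α≡)))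

4n²+5≤n⁶ : ∀ {n} → 2 ≤ n → suc (n * n * 4 + 4) ≤ n ^ 6
4n²+5≤n⁶ {n@(suc (suc _))} 2≤n = begin
  suc (n * n * 4 + 4)   ≡⟨ sym (+-suc (n * n * 4) 4) ⟩
  n * n * 4 + 5         ≤⟨ +-monoʳ-≤ (n * n * 4) (*-monoˡ-≤ 5 {1} {n * n} (s≤s z≤n)) ⟩
  n * n * 4 + n * n * 5 ≡⟨ sym (*-distribˡ-+ (n * n) 4 5) ⟩
  n * n * 9             ≤⟨ *-monoʳ-≤ (n * n) (m≤m+n 9 7) ⟩
  n * n * 16            ≤⟨ *-monoʳ-≤ (n * n) (^-monoˡ-≤ 4 2≤n) ⟩
  n * n * n ^ 4         ≡⟨ *-assoc n n (n ^ 4) ⟩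
  n ^ 6                 ∎
  where open ≤-Reasoning
4n²+5≤n⁶ {suc zero} (s≤s ())

size-bound : ∀ {n k T L} → 2 ≤ n → 1 ≤ k → T ≤ n ^ k → L ≤ n * n → 1 + T * (L * 4 + 4) ≤ n ^ (7 * k)
size-bound {n@(suc (suc _))} {k} {T} {L} 2≤n 1≤k T≤ L≤ = begin
  1 + T * (L * 4 + 4)               ≤⟨ +-monoʳ-≤ 1 (*-mono-≤ T≤ (+-monoˡ-≤ 4 (*-monoˡ-≤ 4 L≤))) ⟩
  1 + n ^ k * (n * n * 4 + 4)       ≤⟨ +-monoˡ-≤ _ (m^n>0 n k) ⟩
  n ^ k + n ^ k * (n * n * 4 + 4)   ≡⟨ sym (*-suc (n ^ k) _) ⟩
  n ^ k * suc (n * n * 4 + 4)       ≤⟨ *-monoʳ-≤ (n ^ k) (4n²+5≤n⁶ 2≤n) ⟩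
  n ^ k * n ^ 6                     ≡⟨ sym (^-distribˡ-+-* n k 6) ⟩
  n ^ (k + 6)                       ≤⟨ ^-monoʳ-≤ n (+-monoʳ-≤ k (*-monoʳ-≤ 6 1≤k)) ⟩
  n ^ (7 * k)                       ∎
  where open ≤-Reasoning
size-bound {suc zero} (s≤s ())

size-lintopCircuit : ∀ {n k} → 1 ≤ k → k < n → size (proj₂ (lintopCircuit n k)) ≤ n ^ (7 * k)
size-lintopCircuit {n} {k} 1≤k k<n = begin
  size (proj₂ (lintopCircuit n k))                 ≡⟨ size-dnf (offDiagonal n) βs ⟩
  1 + length βs * (length (offDiagonal n) * 4 + 4) ≤⟨ size-bound (≤-trans (s≤s 1≤k) k<n) 1≤k
                                                                  length-βs (length-offDiagonal n) ⟩
  n ^ (7 * k)                                      ∎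
  where
  open ≤-Reasoning
  βs : List (Var n → Bool)
  βs = lintopMinterms n k
  length-βs : length βs ≤ n ^ k
  length-βs = begin
    length βs              ≡⟨ length-map minterm (orderings n k) ⟩
    length (orderings n k) ≤⟨ length-filter _ (vectors n k) ⟩
    length (vectors n k)   ≡⟨ length-vectors n k ⟩
    n ^ k                  ∎

proposition6 : Σ ℕ λ C → 1 ≤ C × ((n k : ℕ) → 1 ≤ k → k < n → Σ ℕ λ m → Σ (DAG (Var n) (suc m)) λ D → IsDNNF D × LeavesIn OffDiag D × size D ≤ n ^ (C * k) × Expresses k D)
proposition6 = 7 , s≤s z≤n , λ n k 1≤k k<n →
  proj₁ (lintopCircuit n k) , proj₂ (lintopCircuit n k) ,
  isDNNF-dnf (offDiagonal n) (lintopMinterms n k) (offDiagonal-unique n) ,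
  leavesIn-dnf (offDiagonal n) (lintopMinterms n k) (All.tabulate ∈-offDiagonal⁻) ,
  size-lintopCircuit 1≤k k<n ,
  lintopCircuit-expresses n k
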